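{- Let $n\ge5$ and let $\Delta_n$ be a uniform flag complex on the vertex set $V_n$ representing a triangulation of $\partial P_n$. Assume that exactly one of the types $THTH$ and $HTHT$ of pairs of arrows nests and the other does not nest, and that pairs of both types $THHT$ and $HTTH$ cross. Then pairs of both types $TTHH$ and $HHTT$ nest.
   Context: $P_n$ is the convex hull of $e_j-e_i$ ($i\ne j$) in $\mathbb{R}^{n+1}$. An arrow $(i,j)$, $i\ne j\in\{1,\dots,n+1\}$, with tail $i$ and head $j$, is identified with $e_j-e_i$; $V_n$ is the set of arrows. A complex on $V_n$ represents a triangulation of $\partial P_n$ if the convex hulls of its faces form a triangulation of $\partial P_n$. A flag complex on $V_n$ is uniform if whether a pair $\{(i_1,j_1),(i_2,j_2)\}$ is an edge depends only on the equalities and inequalities among $i_1,i_2,j_1,j_2$. For two arrows with four distinct endpoints $p_1<\dots<p_4$, the type is the $T/H$ word recording tails/heads at $p_1,\dots,p_4$; the pair nests if it joins $\{p_1,p_4\},\{p_2,p_3\}$, crosses if it joins $\{p_1,p_3\},\{p_2,p_4\}$. "Type $W$ nests" means nesting pairs of type $W$ are edges, "does not nest" that they are not; "type $W$ crosses" means crossing pairs of type $W$ are edges. -}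

module Defs where

open import Data.Nat using (ℕ; suc)
open import Data.Fin using (Fin; zero; suc; _≟_)
import Data.Fin as F
open import Data.Rational using (ℚ; 0ℚ; 1ℚ; _+_; _*_; _-_; _≤_; _<_; ∣_∣)
open import Data.List using (List; []; _∷_; length; zipWith; foldr)
open import Data.List.Relation.Unary.All using (All)
open import Data.List.Relation.Unary.Any using (Any)
open import Data.List.Relation.Unary.AllPairs using (AllPairs)
open import Data.List.Relation.Unary.Unique.Propositional using (Unique)
open import Data.List.Membership.Propositional using (_∈_)
open import Data.Product using (Σ; ∃; _×_; _,_)
open import Data.Sum using (_⊎_)
open import Relation.Nullary using (¬_; does)
open import Relation.Binary.PropositionalEquality using (_≡_; _≢_)
open import Data.Bool using (if_then_else_)

-- Arrows on {1,…,n+1} (encoded as Fin (suc n), order of Fin = order of ℕ)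

record Arrow (n : ℕ) : Set where
  constructor arrow
  field
    tail : Fin (suc n)
    head : Fin (suc n)
    distinct : tail ≢ head
open Arrow public

Point : ℕ → Set
Point n = Fin (suc n) → ℚ

vec : ∀ {n} → Arrow n → Point n
vec a k = (if does (k ≟ head a) then 1ℚ else 0ℚ) - (if does (k ≟ tail a) then 1ℚ else 0ℚ)

sumℚ : List ℚ → ℚ
sumℚ = foldr _+_ 0ℚ

combo : ∀ {n} → List ℚ → List (Arrow n) → Point n
combo λs σ k = sumℚ (zipWith (λ l a → l * vec a k) λs σ)

InConv : ∀ {n} → Point n → List (Arrow n) → Set
InConv x σ = Σ (List ℚ) λ λs →
  (length λs ≡ length σ) × All (0ℚ ≤_) λs × (sumℚ λs ≡ 1ℚ) × (∀ k → x k ≡ combo λs σ k)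

AffInd : ∀ {n} → List (Arrow n) → Set
AffInd σ = ∀ (μs : List ℚ) → length μs ≡ length σ → sumℚ μs ≡ 0ℚ →
  (∀ k → combo μs σ k ≡ 0ℚ) → All (_≡ 0ℚ) μs

-- P_n = conv(V_n): convex combinations of finitely many arrows
InP : ∀ {n} → Point n → Set
InP x = ∃ λ (σ : List (Arrow _)) → InConv x σ

-- the affine (here: linear) hull of P_n: coordinate sum 0
sumCoords : ∀ {n} → Point n → ℚ
sumCoords {n} x = sumℚ (Data.List.map x (Data.List.allFin (suc n)))
  where import Data.List

-- relative boundary of P_n inside the hyperplane {Σ x_k = 0} (max-norm balls)
InBoundary : ∀ {n} → Point n → Set
InBoundary {n} x = InP x × (∀ (ε : ℚ) → 0ℚ < ε →
  ∃ λ (y : Point n) → (sumCoords y ≡ 0ℚ) × (∀ k → ∣ x k - y k ∣ < ε) × ¬ InP y)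

-- Flag complex on V_n given by its edge relation E: faces = cliques

Face : ∀ {n} → (Arrow n → Arrow n → Set) → List (Arrow n) → Set
Face E σ = Unique σ × AllPairs E σ

_⊆ₗ_ : ∀ {A : Set} → List A → List A → Set
ρ ⊆ₗ σ = All (_∈ σ) ρ

RepresentsTriangulation : ∀ {n} → (Arrow n → Arrow n → Set) → Set
RepresentsTriangulation {n} E =
  (∀ σ → Face E σ → AffInd σ)
  × (∀ σ → Face E σ → ∀ (x : Point n) → InConv x σ → InBoundary x)
  × (∀ (x : Point n) → InBoundary x → ∃ λ σ → Face E σ × InConv x σ)
  × (∀ σ τ → Face E σ → Face E τ → ∀ (x : Point n) → InConv x σ → InConv x τ →
       ∃ λ ρ → ρ ⊆ₗ σ × ρ ⊆ₗ τ × InConv x ρ)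

quad : ∀ {n} → Arrow n → Arrow n → Fin 4 → Fin (suc n)
quad a b zero = tail a
quad a b (suc zero) = head a
quad a b (suc (suc zero)) = tail b
quad a b (suc (suc (suc zero))) = head b

SamePattern : ∀ {n} → (Fin 4 → Fin (suc n)) → (Fin 4 → Fin (suc n)) → Set
SamePattern f g = ∀ p q → (f p F.< f q → g p F.< g q) × (g p F.< g q → f p F.< f q)

Symmetric : ∀ {n} → (Arrow n → Arrow n → Set) → Set
Symmetric E = ∀ a b → E a b → E b a

Uniform : ∀ {n} → (Arrow n → Arrow n → Set) → Set
Uniform E = ∀ a b a' b' → SamePattern (quad a b) (quad a' b') → E a b → E a' b'

data Letter : Set where
  T H : Letter

Role : ∀ {n} → Arrow n → Fin (suc n) → Letter → Set
Role a p T = tail a ≡ p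
Role a p H = head a ≡ p

Increasing4 : ∀ {n} → Fin (suc n) → Fin (suc n) → Fin (suc n) → Fin (suc n) → Set
Increasing4 p₁ p₂ p₃ p₄ = p₁ F.< p₂ × p₂ F.< p₃ × p₃ F.< p₄

NestingPair : ∀ {n} → Letter → Letter → Letter → Letter → Arrow n → Arrow n → Set
NestingPair w₁ w₂ w₃ w₄ a b = ∃ λ p₁ → ∃ λ p₂ → ∃ λ p₃ → ∃ λ p₄ →
  Increasing4 p₁ p₂ p₃ p₄ × Role a p₁ w₁ × Role a p₄ w₄ × Role b p₂ w₂ × Role b p₃ w₃

CrossingPair : ∀ {n} → Letter → Letter → Letter → Letter → Arrow n → Arrow n → Set
CrossingPair w₁ w₂ w₃ w₄ a b = ∃ λ p₁ → ∃ λ p₂ → ∃ λ p₃ → ∃ λ p₄ →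
  Increasing4 p₁ p₂ p₃ p₄ × Role a p₁ w₁ × Role a p₃ w₃ × Role b p₂ w₂ × Role b p₄ w₄

Nests : ∀ {n} → (Arrow n → Arrow n → Set) → Letter → Letter → Letter → Letter → Set
Nests E w₁ w₂ w₃ w₄ = ∀ a b → NestingPair w₁ w₂ w₃ w₄ a b → E a b

DoesNotNest : ∀ {n} → (Arrow n → Arrow n → Set) → Letter → Letter → Letter → Letter → Set
DoesNotNest E w₁ w₂ w₃ w₄ = ∀ a b → NestingPair w₁ w₂ w₃ w₄ a b → ¬ E a b

Crosses : ∀ {n} → (Arrow n → Arrow n → Set) → Letter → Letter → Letter → Letter → Set
Crosses E w₁ w₂ w₃ w₄ = ∀ a b → CrossingPair w₁ w₂ w₃ w₄ a b → E a b

{-# OPTIONS --safe #-}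
module Submission where

-- Let a = t₁→h₁ and b = t₂→h₂ have four distinct endpoints.
-- Their midpoint m is also the midpoint of the swapped pair t₁→h₂, t₂→h₁. It
-- lies on ∂P_n because the indicator of {h₁, h₂} is at most 1 on P_n and
-- equals 1 at m. Take a face σ whose hull contains m. Slightly perturbing that
-- functional shows that σ has an arrow from t₁ into {h₁, h₂} and an arrow from
-- {t₁, t₂} into h₁, and similarly at t₂ and h₂. So unless σ contains both
-- arrows of the swapped pair, it contains copies of a and b. Hence if the
-- swapped pairs are never edges, the pair is an edge; in particular TTHH nests
-- as soon as TTHH does not cross, and the same holds for HHTT.
--
-- On the points 0 < 1 < … < 5, suppose the TTHH crossing pair 0→3, 2→5 were
-- an edge. Then the crossing hypotheses make {0→3, 2→5, 4→1} a clique. In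
-- either case of the hypothesis on THTH and HTHT, a second clique exists on
-- the same tails with the heads rotated. The two triangles have the same
-- barycentre but no common vertex, which contradicts the requirement that the
-- faces of a triangulation meet in a common face. The case HHTT uses the
-- triangles on the tails 1, 3, 5.

open import Defs
open import Data.Nat using (ℕ; _≤_; zero; suc; z≤n; s≤s)
open import Data.Nat.Properties using (suc-injective)
open import Data.Product using (_×_; _,_; proj₁; proj₂; ∃)
open import Data.Sum using (_⊎_; inj₁; inj₂)
open import Data.Bool using (true; false; if_then_else_; _∨_)
open import Data.Bool.Properties using (∨-zeroʳ)
open import Data.Empty using (⊥; ⊥-elim)
import Data.Integer as ℤ
open import Data.Fin as Fin using (Fin; zero; suc; _≟_; #_)
import Data.Fin.Properties as Finₚ
open import Data.Vec using ([]; _∷_; lookup)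
open import Data.List using (List; []; _∷_; length; zipWith; tabulate)
open import Data.List.Properties using (map-tabulate)
open import Data.List.Relation.Unary.All as All using (All; []; _∷_)
open import Data.List.Relation.Unary.All.Properties using (¬Any⇒All¬)
open import Data.List.Relation.Unary.Any as Any using (Any; here; there; any?)
open import Data.List.Relation.Unary.AllPairs using (AllPairs; []; _∷_)
open import Data.List.Membership.Propositional using (_∈_; find)
open import Data.Rational as ℚ using (ℚ; 0ℚ; 1ℚ; ½; _+_; _*_; _-_; -_; ∣_∣)
import Data.Rational.Properties as ℚₚ
open import Data.Rational.Solver using (module +-*-Solver)
open import Algebra.Bundles using (Ring)
open import Algebra.Properties.Semiring.Sum (Ring.semiring ℚₚ.+-*-ring)
  using (sum; ∑-distrib-+; *-distribˡ-sum; sum-cong-≗; sum-replicate-zero)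
open import Function using (_∘_; id)
open import Relation.Binary.Core using (_Preserves_⟶_)
open import Relation.Binary.Definitions using (tri<; tri≈; tri>)
open import Relation.Binary.PropositionalEquality
open import Relation.Nullary using (¬_; Dec; yes; no; does)
open import Relation.Nullary.Decidable
  using (True; False; toWitness; toWitnessFalse; dec-true; dec-false)

open +-*-Solver using (solve; _:+_; _:*_; _:-_; :-_; _:=_; con)

decide-≤ : ∀ {p q} {p≤q : True (p ℚₚ.≤? q)} → p ℚ.≤ q
decide-≤ {p≤q = p≤q} = toWitness p≤q

decide-< : ∀ {p q} {p<q : True (p ℚₚ.<? q)} → p ℚ.< q
decide-< {p<q = p<q} = toWitness p<q

≤⇒≯ : ∀ {p q} → p ℚ.≤ q → ¬ (q ℚ.< p)
≤⇒≯ p≤q q<p = ℚₚ.<-irrefl refl (ℚₚ.<-≤-trans q<p p≤q)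

minus-mono-≤ : ∀ {p q r s} → p ℚ.≤ q → r ℚ.≤ s → p - s ℚ.≤ q - r
minus-mono-≤ p≤q r≤s = ℚₚ.+-mono-≤ p≤q (ℚₚ.neg-antimono-≤ r≤s)

if-preserves : ∀ {A : Set} (P : A → Set) b {x y : A} → P x → P y → P (if b then x else y)
if-preserves P true  px py = px
if-preserves P false px py = py

-- Linear functionals

δ : ∀ {m} → Fin m → Fin m → ℚ
δ p k = if does (k ≟ p) then 1ℚ else 0ℚ

𝟙 : ∀ {m} → Fin m → ℚ
𝟙 _ = 1ℚ

⟪_,_⟫ : ∀ {m} → (Fin m → ℚ) → (Fin m → ℚ) → ℚ
⟪ w , x ⟫ = sum (λ k → w k * x k)

rise : ∀ {n} → Point n → Arrow n → ℚ
rise w a = w (head a) - w (tail a)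

module _ {m : ℕ} (w : Fin m → ℚ) where

  ⟪⟫-cong : ∀ {x y : Fin m → ℚ} → (∀ k → x k ≡ y k) → ⟪ w , x ⟫ ≡ ⟪ w , y ⟫
  ⟪⟫-cong x≗y = sum-cong-≗ (λ k → cong (w k *_) (x≗y k))

  ⟪⟫-zero : ⟪ w , (λ _ → 0ℚ) ⟫ ≡ 0ℚ
  ⟪⟫-zero = trans (sum-cong-≗ (λ k → ℚₚ.*-zeroʳ (w k))) (sum-replicate-zero m)

  ⟪⟫-+ : ∀ x y → ⟪ w , (λ k → x k + y k) ⟫ ≡ ⟪ w , x ⟫ + ⟪ w , y ⟫
  ⟪⟫-+ x y = trans (sum-cong-≗ (λ k → ℚₚ.*-distribˡ-+ (w k) (x k) (y k)))
                   (∑-distrib-+ (λ k → w k * x k) (λ k → w k * y k))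

  ⟪⟫-* : ∀ c x → ⟪ w , (λ k → c * x k) ⟫ ≡ c * ⟪ w , x ⟫
  ⟪⟫-* c x = trans (sum-cong-≗ (λ k → exchange (w k) c (x k)))
                   (sym (*-distribˡ-sum c (λ k → w k * x k)))
    where
    exchange : ∀ u v z → u * (v * z) ≡ v * (u * z)
    exchange = solve 3 (λ u v z → u :* (v :* z) := v :* (u :* z)) refl

⟪⟫-δ : ∀ {m} (w : Fin m → ℚ) p → ⟪ w , δ p ⟫ ≡ w p
⟪⟫-δ {suc m} w zero =
  trans (cong₂ _+_ (ℚₚ.*-identityʳ (w zero)) (⟪⟫-zero (w ∘ suc))) (ℚₚ.+-identityʳ (w zero))
⟪⟫-δ {suc m} w (suc p) =
  trans (cong₂ _+_ (ℚₚ.*-zeroʳ (w zero)) (⟪⟫-δ (w ∘ suc) p)) (ℚₚ.+-identityˡ (w (suc p)))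

⟪⟫-vec : ∀ {n} (w : Point n) a → ⟪ w , vec a ⟫ ≡ rise w a
⟪⟫-vec w a = begin
  ⟪ w , vec a ⟫
    ≡⟨ ⟪⟫-cong w (λ k → minus-as-plus (δ (head a) k) (δ (tail a) k)) ⟩
  ⟪ w , (λ k → δ (head a) k + - 1ℚ * δ (tail a) k) ⟫
    ≡⟨ ⟪⟫-+ w (δ (head a)) (λ k → - 1ℚ * δ (tail a) k) ⟩
  ⟪ w , δ (head a) ⟫ + ⟪ w , (λ k → - 1ℚ * δ (tail a) k) ⟫
    ≡⟨ cong (⟪ w , δ (head a) ⟫ +_) (⟪⟫-* w (- 1ℚ) (δ (tail a))) ⟩
  ⟪ w , δ (head a) ⟫ + - 1ℚ * ⟪ w , δ (tail a) ⟫
    ≡⟨ cong₂ (λ u v → u + - 1ℚ * v) (⟪⟫-δ w (head a)) (⟪⟫-δ w (tail a)) ⟩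
  w (head a) + - 1ℚ * w (tail a)
    ≡⟨ minus-as-plus (w (head a)) (w (tail a)) ⟨
  rise w a ∎
  where
  open ≡-Reasoning
  minus-as-plus : ∀ u v → u - v ≡ u + - 1ℚ * v
  minus-as-plus = solve 2 (λ u v → u :- v := u :+ con (- 1ℚ) :* v) refl

⟪⟫-combo : ∀ {n} (w : Point n) λs σ →
  ⟪ w , combo λs σ ⟫ ≡ sumℚ (zipWith (λ l a → l * rise w a) λs σ)
⟪⟫-combo w []       σ       = ⟪⟫-zero w
⟪⟫-combo w (l ∷ λs) []      = ⟪⟫-zero w
⟪⟫-combo w (l ∷ λs) (a ∷ σ) = trans (⟪⟫-+ w (λ k → l * vec a k) (combo λs σ))
  (cong₂ _+_ (trans (⟪⟫-* w l (vec a)) (cong (l *_) (⟪⟫-vec w a))) (⟪⟫-combo w λs σ))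

convex-≤ : ∀ {A : Set} (g : A → ℚ) {M} λs xs → length λs ≡ length xs → All (0ℚ ℚ.≤_) λs →
  All (λ x → g x ℚ.≤ M) xs → sumℚ (zipWith (λ l x → l * g x) λs xs) ℚ.≤ M * sumℚ λs
convex-≤ g {M} []       []       _   []           []            = ℚₚ.≤-reflexive (sym (ℚₚ.*-zeroʳ M))
convex-≤ g {M} (l ∷ λs) (x ∷ xs) len (l≥0 ∷ λs≥0) (gx≤M ∷ gxs≤M) = begin
  l * g x + sumℚ (zipWith (λ l x → l * g x) λs xs)
    ≤⟨ ℚₚ.+-mono-≤ (ℚₚ.*-monoˡ-≤-nonNeg l {{ℚ.nonNegative l≥0}} gx≤M)
                   (convex-≤ g λs xs (suc-injective len) λs≥0 gxs≤M) ⟩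
  l * M + M * sumℚ λs
    ≡⟨ solve 3 (λ l M s → l :* M :+ M :* s := M :* (l :+ s)) refl l M (sumℚ λs) ⟩
  M * (l + sumℚ λs) ∎
  where open ℚₚ.≤-Reasoning

convex-exceeds : ∀ {A : Set} (g : A → ℚ) {M} λs xs → length λs ≡ length xs → All (0ℚ ℚ.≤_) λs →
  sumℚ λs ≡ 1ℚ → M ℚ.< sumℚ (zipWith (λ l x → l * g x) λs xs) → Any (λ x → M ℚ.< g x) xs
convex-exceeds g {M} λs xs len λs≥0 Σλs≡1 M<Σ with any? (λ x → M ℚₚ.<? g x) xs
... | yes found = found
... | no none = ⊥-elim (≤⇒≯ Σ≤M M<Σ)
  where
  Σ≤M : sumℚ (zipWith (λ l x → l * g x) λs xs) ℚ.≤ M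
  Σ≤M = ℚₚ.≤-trans (convex-≤ g λs xs len λs≥0 (All.map ℚₚ.≮⇒≥ (¬Any⇒All¬ xs none)))
          (ℚₚ.≤-reflexive (trans (cong (M *_) Σλs≡1) (ℚₚ.*-identityʳ M)))

-- The boundary of P_n

module _ {n : ℕ} where

  InConv-resp : ∀ {x y : Point n} {σ} → (∀ k → x k ≡ y k) → InConv x σ → InConv y σ
  InConv-resp x≗y (λs , len , λs≥0 , Σλs≡1 , x≗combo) =
    λs , len , λs≥0 , Σλs≡1 , λ k → trans (sym (x≗y k)) (x≗combo k)

  InConv-exceeds : ∀ {x σ} (w : Point n) {M} → InConv x σ → M ℚ.< ⟪ w , x ⟫ →
    Any (λ a → M ℚ.< rise w a) σ
  InConv-exceeds {σ = σ} w (λs , len , λs≥0 , Σλs≡1 , x≗combo) M<⟪w,x⟫ =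
    convex-exceeds (rise w) λs σ len λs≥0 Σλs≡1
      (subst (_ ℚ.<_) (trans (⟪⟫-cong w x≗combo) (⟪⟫-combo w λs σ)) M<⟪w,x⟫)

  InP⇒⟪𝟙⟫≡0 : ∀ {x : Point n} → InP x → ⟪ 𝟙 , x ⟫ ≡ 0ℚ
  InP⇒⟪𝟙⟫≡0 (σ , λs , _ , _ , _ , x≗combo) =
    trans (⟪⟫-cong 𝟙 x≗combo) (trans (⟪⟫-combo 𝟙 λs σ) (rises-vanish λs σ))
    where
    rises-vanish : ∀ λs σ → sumℚ (zipWith (λ l a → l * rise 𝟙 a) λs σ) ≡ 0ℚ
    rises-vanish []       _       = refl
    rises-vanish (_ ∷ _)  []      = refl
    rises-vanish (l ∷ λs) (_ ∷ σ) = cong₂ _+_ (ℚₚ.*-zeroʳ l) (rises-vanish λs σ)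

  sumCoords-⟪𝟙⟫ : ∀ (x : Point n) → sumCoords x ≡ ⟪ 𝟙 , x ⟫
  sumCoords-⟪𝟙⟫ x = trans (cong sumℚ (map-tabulate id x))
    (trans (sumℚ-tabulate x) (sum-cong-≗ (λ k → sym (ℚₚ.*-identityˡ (x k)))))
    where
    sumℚ-tabulate : ∀ {m} (f : Fin m → ℚ) → sumℚ (tabulate f) ≡ sum f
    sumℚ-tabulate {zero}  f = refl
    sumℚ-tabulate {suc m} f = cong (f zero +_) (sumℚ-tabulate (f ∘ suc))

  ∣vec∣≤1 : ∀ (a : Arrow n) k → ∣ vec a k ∣ ℚ.≤ 1ℚ
  ∣vec∣≤1 a k = bits (does (k ≟ head a)) (does (k ≟ tail a))
    where
    bits : ∀ b c → ∣ (if b then 1ℚ else 0ℚ) - (if c then 1ℚ else 0ℚ) ∣ ℚ.≤ 1ℚ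
    bits true  true  = decide-≤
    bits true  false = decide-≤
    bits false true  = decide-≤
    bits false false = decide-≤

  -- Moving x a little along an arrow a with positive rise leaves P_n, since
  -- no vertex of P_n rises above c.
  supporting⇒InBoundary : ∀ {x : Point n} (w : Point n) {c} → (∀ a → rise w a ℚ.≤ c) →
    (a : Arrow n) → 0ℚ ℚ.< rise w a → InP x → ⟪ w , x ⟫ ≡ c → InBoundary x
  supporting⇒InBoundary {x} w {c} rise≤c a rise>0 x∈P ⟪w,x⟫≡c = x∈P , escape
    where
    escape : ∀ ε → 0ℚ ℚ.< ε →
      ∃ λ (y : Point n) → (sumCoords y ≡ 0ℚ) × (∀ k → ∣ x k - y k ∣ ℚ.< ε) × ¬ InP y
    escape ε ε>0 = y , sum-y , close , outside
      where
      η : ℚ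
      η = ½ * ε
      η>0 : 0ℚ ℚ.< η
      η>0 = subst (ℚ._< η) (ℚₚ.*-zeroʳ ½) (ℚₚ.*-monoʳ-<-pos ½ ε>0)
      y : Point n
      y k = x k + η * vec a k
      ⟪⟫-y : ∀ v → ⟪ v , y ⟫ ≡ ⟪ v , x ⟫ + η * rise v a
      ⟪⟫-y v = trans (⟪⟫-+ v x (λ k → η * vec a k))
        (cong (⟪ v , x ⟫ +_) (trans (⟪⟫-* v η (vec a)) (cong (η *_) (⟪⟫-vec v a))))
      sum-y : sumCoords y ≡ 0ℚ
      sum-y = trans (sumCoords-⟪𝟙⟫ y)
        (trans (⟪⟫-y 𝟙) (cong₂ _+_ (InP⇒⟪𝟙⟫≡0 x∈P) (ℚₚ.*-zeroʳ η)))
      close : ∀ k → ∣ x k - y k ∣ ℚ.< ε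
      close k = ℚₚ.≤-<-trans (begin
        ∣ x k - y k ∣
          ≡⟨ cong ∣_∣ (solve 2 (λ u v → u :- (u :+ v) := :- v) refl (x k) (η * vec a k)) ⟩
        ∣ - (η * vec a k) ∣
          ≡⟨ trans (ℚₚ.∣-p∣≡∣p∣ (η * vec a k)) (ℚₚ.∣p*q∣≡∣p∣*∣q∣ η (vec a k)) ⟩
        ∣ η ∣ * ∣ vec a k ∣
          ≤⟨ ℚₚ.*-monoˡ-≤-nonNeg ∣ η ∣ {{ℚₚ.∣-∣-nonNeg η}} (∣vec∣≤1 a k) ⟩
        ∣ η ∣ * 1ℚ
          ≡⟨ trans (ℚₚ.*-identityʳ ∣ η ∣) (ℚₚ.0≤p⇒∣p∣≡p (ℚₚ.<⇒≤ η>0)) ⟩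
        η ∎) η<ε
        where
        open ℚₚ.≤-Reasoning
        η<ε : η ℚ.< ε
        η<ε = subst (η ℚ.<_) (ℚₚ.*-identityˡ ε)
                (ℚₚ.*-monoˡ-<-pos ε {{ℚ.positive ε>0}} {½} {1ℚ} decide-<)
      c<⟪w,y⟫ : c ℚ.< ⟪ w , y ⟫
      c<⟪w,y⟫ = subst₂ ℚ._<_ (ℚₚ.+-identityʳ c) (sym (trans (⟪⟫-y w) (cong (_+ η * rise w a) ⟪w,x⟫≡c)))
        (ℚₚ.+-monoʳ-< c (subst (ℚ._< η * rise w a) (ℚₚ.*-zeroʳ η)
                                (ℚₚ.*-monoʳ-<-pos η {{ℚ.positive η>0}} rise>0)))
      outside : ¬ InP y
      outside (σ , y∈σ) =
        let v , c<rise = Any.satisfied (InConv-exceeds w y∈σ c<⟪w,y⟫) in ≤⇒≯ (rise≤c v) c<rise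

indicator : ∀ {m} → Fin m → Fin m → Fin m → ℚ
indicator p q k = if does (k ≟ p) ∨ does (k ≟ q) then 1ℚ else 0ℚ

module Indicator {m : ℕ} (p q : Fin m) where

  indicator-left : indicator p q p ≡ 1ℚ
  indicator-left rewrite dec-true (p ≟ p) refl = refl

  indicator-right : indicator p q q ≡ 1ℚ
  indicator-right rewrite dec-true (q ≟ q) refl | ∨-zeroʳ (does (q ≟ p)) = refl

  indicator-outside : ∀ {k} → k ≢ p → k ≢ q → indicator p q k ≡ 0ℚ
  indicator-outside {k} k≢p k≢q rewrite dec-false (k ≟ p) k≢p | dec-false (k ≟ q) k≢q = refl

  indicator-≥0 : ∀ k → 0ℚ ℚ.≤ indicator p q k
  indicator-≥0 k = if-preserves (0ℚ ℚ.≤_) (does (k ≟ p) ∨ does (k ≟ q)) decide-≤ decide-≤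

  indicator-≤1 : ∀ k → indicator p q k ℚ.≤ 1ℚ
  indicator-≤1 k = if-preserves (ℚ._≤ 1ℚ) (does (k ≟ p) ∨ does (k ≟ q)) decide-≤ decide-≤

-- Lowering the indicator of {p, q} to -1 at s makes the arrows from s into
-- {p, q} the only ones rising by more than 1.
weight : ∀ {m} → Fin m → Fin m → Fin m → Fin m → ℚ
weight s p q k = if does (k ≟ s) then - 1ℚ else indicator p q k

module Weight {m : ℕ} (s p q : Fin m) where

  open Indicator p q

  weight-at-s : weight s p q s ≡ - 1ℚ
  weight-at-s rewrite dec-true (s ≟ s) refl = refl

  weight-off-s : ∀ {k} → k ≢ s → weight s p q k ≡ indicator p q k
  weight-off-s {k} k≢s rewrite dec-false (k ≟ s) k≢s = refl

  weight-gap : ∀ {x y} → 1ℚ ℚ.< weight s p q y - weight s p q x → x ≡ s × (y ≡ p ⊎ y ≡ q)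
  weight-gap {x} {y} gap = classify (x ≟ s) (y ≟ p) (y ≟ q)
    where
    classify : Dec (x ≡ s) → Dec (y ≡ p) → Dec (y ≡ q) → x ≡ s × (y ≡ p ⊎ y ≡ q)
    classify (yes x≡s)  (yes y≡p) _         = x≡s , inj₁ y≡p
    classify (yes x≡s)  (no _)    (yes y≡q) = x≡s , inj₂ y≡q
    classify (yes refl) (no y≢p)  (no y≢q)  =
      ⊥-elim (≤⇒≯ (ℚₚ.≤-trans (minus-mono-≤ y≤0 (ℚₚ.≤-reflexive (sym weight-at-s))) decide-≤) gap)
      where
      y≤0 : weight s p q y ℚ.≤ 0ℚ
      y≤0 = if-preserves (ℚ._≤ 0ℚ) (does (y ≟ s)) decide-≤ (ℚₚ.≤-reflexive (indicator-outside y≢p y≢q))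
    classify (no x≢s) _ _ =
      ⊥-elim (≤⇒≯ (ℚₚ.≤-trans (minus-mono-≤ y≤1 x≥0) decide-≤) gap)
      where
      y≤1 : weight s p q y ℚ.≤ 1ℚ
      y≤1 = if-preserves (ℚ._≤ 1ℚ) (does (y ≟ s)) decide-≤ (indicator-≤1 y)
      x≥0 : 0ℚ ℚ.≤ weight s p q x
      x≥0 = subst (0ℚ ℚ.≤_) (sym (weight-off-s x≢s)) (indicator-≥0 x)

mid : ∀ {n} → Arrow n → Arrow n → Point n
mid a b = combo (½ ∷ ½ ∷ []) (a ∷ b ∷ [])

module _ {n : ℕ} (a b : Arrow n) where

  mid-comm : ∀ k → mid a b k ≡ mid b a k
  mid-comm k = solve 3 (λ h u v → h :* u :+ (h :* v :+ con 0ℚ) := h :* v :+ (h :* u :+ con 0ℚ))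
    refl ½ (vec a k) (vec b k)

  mid-in-hull : InConv (mid a b) (a ∷ b ∷ [])
  mid-in-hull = (½ ∷ ½ ∷ []) , refl , (decide-≤ ∷ decide-≤ ∷ []) , refl , λ k → refl

  ⟪⟫-mid : ∀ (w : Point n) → ⟪ w , mid a b ⟫ ≡ ½ * (rise w a + rise w b)
  ⟪⟫-mid w = trans (⟪⟫-combo w (½ ∷ ½ ∷ []) (a ∷ b ∷ []))
    (solve 3 (λ h u v → h :* u :+ (h :* v :+ con 0ℚ) := h :* (u :+ v)) refl ½ (rise w a) (rise w b))

  mid-InBoundary : tail a ≢ head b → tail b ≢ head a → InBoundary (mid a b)
  mid-InBoundary ta≢hb tb≢ha =
    supporting⇒InBoundary ι rise-ι≤1 a (subst (0ℚ ℚ.<_) (sym rise-a) decide-<) (_ , mid-in-hull)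
      (trans (⟪⟫-mid ι) (cong₂ (λ u v → ½ * (u + v)) rise-a rise-b))
    where
    open Indicator (head a) (head b)
    ι : Point n
    ι = indicator (head a) (head b)
    rise-ι≤1 : ∀ v → rise ι v ℚ.≤ 1ℚ
    rise-ι≤1 v = ℚₚ.≤-trans (minus-mono-≤ (indicator-≤1 (head v)) (indicator-≥0 (tail v))) decide-≤
    rise-a : rise ι a ≡ 1ℚ
    rise-a = cong₂ _-_ indicator-left (indicator-outside (distinct a) ta≢hb)
    rise-b : rise ι b ≡ 1ℚ
    rise-b = cong₂ _-_ indicator-right (indicator-outside tb≢ha (distinct b))

  tail-witness : tail a ≢ tail b → tail a ≢ head b → tail b ≢ head a → ∀ {σ} → InConv (mid a b) σ →
    Any (λ v → tail v ≡ tail a × (head v ≡ head a ⊎ head v ≡ head b)) σ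
  tail-witness ta≢tb ta≢hb tb≢ha x∈σ = Any.map weight-gap (InConv-exceeds w x∈σ 1<⟪w,mid⟫)
    where
    open Indicator (head a) (head b)
    open Weight (tail a) (head a) (head b)
    w : Point n
    w = weight (tail a) (head a) (head b)
    rise-a : rise w a ≡ 1ℚ - - 1ℚ
    rise-a = cong₂ _-_ (trans (weight-off-s (≢-sym (distinct a))) indicator-left) weight-at-s
    rise-b : rise w b ≡ 1ℚ - 0ℚ
    rise-b = cong₂ _-_ (trans (weight-off-s (≢-sym ta≢hb)) indicator-right)
                       (trans (weight-off-s (≢-sym ta≢tb)) (indicator-outside tb≢ha (distinct b)))
    1<⟪w,mid⟫ : 1ℚ ℚ.< ⟪ w , mid a b ⟫
    1<⟪w,mid⟫ = subst (1ℚ ℚ.<_) (sym (trans (⟪⟫-mid w) (cong₂ (λ u v → ½ * (u + v)) rise-a rise-b)))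
      decide-<

  -- The argument of tail-witness for the reversed arrows, using the negated weight.
  head-witness : head a ≢ head b → tail a ≢ head b → tail b ≢ head a → ∀ {σ} → InConv (mid a b) σ →
    Any (λ v → head v ≡ head a × (tail v ≡ tail a ⊎ tail v ≡ tail b)) σ
  head-witness ha≢hb ta≢hb tb≢ha x∈σ =
    Any.map (λ {v} gap → weight-gap (subst (1ℚ ℚ.<_) (negated-rise v) gap)) (InConv-exceeds w⁻ x∈σ 1<⟪w⁻,mid⟫)
    where
    open Indicator (tail a) (tail b)
    open Weight (head a) (tail a) (tail b)
    w w⁻ : Point n
    w = weight (head a) (tail a) (tail b)
    w⁻ k = - w k
    negated-rise : ∀ v → rise w⁻ v ≡ w (tail v) - w (head v)
    negated-rise v = solve 2 (λ h t → :- h :- :- t := t :- h) refl (w (head v)) (w (tail v))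
    rise-a : rise w⁻ a ≡ 1ℚ - - 1ℚ
    rise-a = trans (negated-rise a) (cong₂ _-_ (trans (weight-off-s (distinct a)) indicator-left) weight-at-s)
    rise-b : rise w⁻ b ≡ 1ℚ - 0ℚ
    rise-b = trans (negated-rise b) (cong₂ _-_ (trans (weight-off-s tb≢ha) indicator-right)
      (trans (weight-off-s (≢-sym ha≢hb)) (indicator-outside (≢-sym ta≢hb) (≢-sym (distinct b)))))
    1<⟪w⁻,mid⟫ : 1ℚ ℚ.< ⟪ w⁻ , mid a b ⟫
    1<⟪w⁻,mid⟫ = subst (1ℚ ℚ.<_) (sym (trans (⟪⟫-mid w⁻) (cong₂ (λ u v → ½ * (u + v)) rise-a rise-b)))
      decide-<

-- Order patterns

module Increasing4-distinct {n : ℕ} {p₁ p₂ p₃ p₄ : Fin (suc n)} (inc : Increasing4 p₁ p₂ p₃ p₄) where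

  private
    p₁<p₂ : p₁ Fin.< p₂
    p₁<p₂ = proj₁ inc
    p₂<p₃ : p₂ Fin.< p₃
    p₂<p₃ = proj₁ (proj₂ inc)
    p₃<p₄ : p₃ Fin.< p₄
    p₃<p₄ = proj₂ (proj₂ inc)

  p₁≢p₂ : p₁ ≢ p₂
  p₁≢p₂ = Finₚ.<⇒≢ p₁<p₂
  p₁≢p₃ : p₁ ≢ p₃
  p₁≢p₃ = Finₚ.<⇒≢ (Finₚ.<-trans p₁<p₂ p₂<p₃)
  p₁≢p₄ : p₁ ≢ p₄
  p₁≢p₄ = Finₚ.<⇒≢ (Finₚ.<-trans p₁<p₂ (Finₚ.<-trans p₂<p₃ p₃<p₄))
  p₂≢p₃ : p₂ ≢ p₃
  p₂≢p₃ = Finₚ.<⇒≢ p₂<p₃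
  p₂≢p₄ : p₂ ≢ p₄
  p₂≢p₄ = Finₚ.<⇒≢ (Finₚ.<-trans p₂<p₃ p₃<p₄)
  p₃≢p₄ : p₃ ≢ p₄
  p₃≢p₄ = Finₚ.<⇒≢ p₃<p₄

lookup-increasing : ∀ {n} {p₁ p₂ p₃ p₄ : Fin (suc n)} → Increasing4 p₁ p₂ p₃ p₄ →
  lookup (p₁ ∷ p₂ ∷ p₃ ∷ p₄ ∷ []) Preserves Fin._<_ ⟶ Fin._<_
lookup-increasing (p₁<p₂ , _ , _) {zero} {suc zero} _ = p₁<p₂
lookup-increasing (p₁<p₂ , p₂<p₃ , _) {zero} {suc (suc zero)} _ = Finₚ.<-trans p₁<p₂ p₂<p₃
lookup-increasing (p₁<p₂ , p₂<p₃ , p₃<p₄) {zero} {suc (suc (suc zero))} _ =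
  Finₚ.<-trans p₁<p₂ (Finₚ.<-trans p₂<p₃ p₃<p₄)
lookup-increasing (_ , p₂<p₃ , _) {suc zero} {suc (suc zero)} _ = p₂<p₃
lookup-increasing (_ , p₂<p₃ , p₃<p₄) {suc zero} {suc (suc (suc zero))} _ = Finₚ.<-trans p₂<p₃ p₃<p₄
lookup-increasing (_ , _ , p₃<p₄) {suc (suc zero)} {suc (suc (suc zero))} _ = p₃<p₄
lookup-increasing _ {_}                   {zero}                   ()
lookup-increasing _ {suc zero}            {suc zero}               (s≤s ())
lookup-increasing _ {suc (suc _)}         {suc zero}               (s≤s ())
lookup-increasing _ {suc (suc zero)}      {suc (suc zero)}         (s≤s (s≤s ()))
lookup-increasing _ {suc (suc (suc _))}   {suc (suc zero)}         (s≤s (s≤s ()))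
lookup-increasing _ {suc (suc (suc zero))} {suc (suc (suc zero))}  (s≤s (s≤s (s≤s ())))

module _ {k m : ℕ} {r : Fin k → Fin m} (r-increasing : r Preserves Fin._<_ ⟶ Fin._<_) where

  increasing-reflects-< : ∀ {i j} → r i Fin.< r j → i Fin.< j
  increasing-reflects-< {i} {j} ri<rj with Finₚ.<-cmp i j
  ... | tri< i<j _ _ = i<j
  ... | tri≈ _ refl _ = ⊥-elim (Finₚ.<-irrefl refl ri<rj)
  ... | tri> _ _ j<i = ⊥-elim (Finₚ.<-asym ri<rj (r-increasing j<i))

  <-through : ∀ {π : Fin 4 → Fin k} {f : Fin 4 → Fin m} → (∀ i → f i ≡ r (π i)) → ∀ i j →
    (f i Fin.< f j → π i Fin.< π j) × (π i Fin.< π j → f i Fin.< f j)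
  <-through f≗rπ i j =
    (λ fi<fj → increasing-reflects-< (subst₂ Fin._<_ (f≗rπ i) (f≗rπ j) fi<fj)) ,
    (λ πi<πj → subst₂ Fin._<_ (sym (f≗rπ i)) (sym (f≗rπ j)) (r-increasing πi<πj))

SamePattern-via : ∀ {k n} {f g : Fin 4 → Fin (suc n)} {r s : Fin k → Fin (suc n)} (π : Fin 4 → Fin k) →
  r Preserves Fin._<_ ⟶ Fin._<_ → s Preserves Fin._<_ ⟶ Fin._<_ →
  (∀ i → f i ≡ r (π i)) → (∀ i → g i ≡ s (π i)) → SamePattern f g
SamePattern-via π r-increasing s-increasing f≗rπ g≗sπ i j =
  proj₂ (<-through s-increasing g≗sπ i j) ∘ proj₁ (<-through r-increasing f≗rπ i j) ,
  proj₂ (<-through r-increasing f≗rπ i j) ∘ proj₁ (<-through s-increasing g≗sπ i j)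

uniform-ends : ∀ {n} {E : Arrow n → Arrow n → Set} → Uniform E → ∀ {a b c d} →
  tail a ≡ tail c → head a ≡ head c → tail b ≡ tail d → head b ≡ head d → E a b → E c d
uniform-ends uniform {a} {b} {c} {d} ta≡tc ha≡hc tb≡td hb≡hd =
  uniform a b c d (SamePattern-via (quad a b) id id (λ _ → refl) (λ i → sym (same-quad i)))
  where
  same-quad : ∀ i → quad a b i ≡ quad c d i
  same-quad zero                   = ta≡tc
  same-quad (suc zero)             = ha≡hc
  same-quad (suc (suc zero))       = tb≡td
  same-quad (suc (suc (suc zero))) = hb≡hd

pick : ∀ {A : Set} → Letter → A → A → A
pick T x y = x
pick H x y = y

pick-map : ∀ {A B : Set} (f : A → B) u {x y : A} → f (pick u x y) ≡ pick u (f x) (f y)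
pick-map f T = refl
pick-map f H = refl

role-ends : ∀ {n} {a : Arrow n} {p q u v} → p ≢ q → Role a p u → Role a q v →
  tail a ≡ pick u p q × head a ≡ pick u q p
role-ends {u = T} {T} p≢q refl ta≡q = ⊥-elim (p≢q ta≡q)
role-ends {u = T} {H} _   ta≡p ha≡q = ta≡p , ha≡q
role-ends {u = H} {T} _   ha≡p ta≡q = ta≡q , ha≡p
role-ends {u = H} {H} p≢q refl ha≡q = ⊥-elim (p≢q ha≡q)

-- Indices, among the four increasing endpoints counted from 0, of tail a, head a,
-- tail b, head b for a crossing pair a, b: a joins 0 and 2, b joins 1 and 3.
crossing-slots : Letter → Letter → Fin 4 → Fin 4
crossing-slots w₁ w₂ =
  lookup (pick w₁ (# 0) (# 2) ∷ pick w₁ (# 2) (# 0) ∷ pick w₂ (# 1) (# 3) ∷ pick w₂ (# 3) (# 1) ∷ [])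

crossing-quad : ∀ {n w₁ w₂ w₃ w₄} {a b : Arrow n} → CrossingPair w₁ w₂ w₃ w₄ a b →
  ∃ λ (r : Fin 4 → Fin (suc n)) →
    r Preserves Fin._<_ ⟶ Fin._<_ × (∀ i → quad a b i ≡ r (crossing-slots w₁ w₂ i))
crossing-quad {n} {w₁} {w₂} {a = a} {b} (p₁ , p₂ , p₃ , p₄ , inc , a₁ , a₃ , b₂ , b₄) =
  r , lookup-increasing inc , quad≗
  where
  open Increasing4-distinct inc
  r : Fin 4 → Fin (suc n)
  r = lookup (p₁ ∷ p₂ ∷ p₃ ∷ p₄ ∷ [])
  quad≗ : ∀ i → quad a b i ≡ r (crossing-slots w₁ w₂ i)
  quad≗ zero                   = trans (proj₁ (role-ends p₁≢p₃ a₁ a₃)) (sym (pick-map r w₁))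
  quad≗ (suc zero)             = trans (proj₂ (role-ends p₁≢p₃ a₁ a₃)) (sym (pick-map r w₁))
  quad≗ (suc (suc zero))       = trans (proj₁ (role-ends p₂≢p₄ b₂ b₄)) (sym (pick-map r w₂))
  quad≗ (suc (suc (suc zero))) = trans (proj₂ (role-ends p₂≢p₄ b₂ b₄)) (sym (pick-map r w₂))

crossing-uniform : ∀ {n} {E : Arrow n → Arrow n → Set} → Uniform E → ∀ {w₁ w₂ w₃ w₄ a b c d} →
  CrossingPair w₁ w₂ w₃ w₄ a b → CrossingPair w₁ w₂ w₃ w₄ c d → E a b → E c d
crossing-uniform uniform {w₁} {w₂} ab cd =
  let r , r-increasing , quad-ab = crossing-quad ab
      s , s-increasing , quad-cd = crossing-quad cd
  in uniform _ _ _ _ (SamePattern-via (crossing-slots w₁ w₂) r-increasing s-increasing quad-ab quad-cd)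

-- Flag triangulations of ∂P_n

HeadsSwapped : ∀ {n} → Arrow n → Arrow n → Arrow n → Arrow n → Set
HeadsSwapped a b c d = tail c ≡ tail a × head c ≡ head b × tail d ≡ tail b × head d ≡ head a

SeparatedPair : ∀ {n} → Letter → Letter → Letter → Letter → Arrow n → Arrow n → Set
SeparatedPair w₁ w₂ w₃ w₄ a b = ∃ λ p₁ → ∃ λ p₂ → ∃ λ p₃ → ∃ λ p₄ →
  Increasing4 p₁ p₂ p₃ p₄ × Role a p₁ w₁ × Role a p₂ w₂ × Role b p₃ w₃ × Role b p₄ w₄

DoesNotCross : ∀ {n} → (Arrow n → Arrow n → Set) → Letter → Letter → Letter → Letter → Set
DoesNotCross E w₁ w₂ w₃ w₄ = ∀ a b → CrossingPair w₁ w₂ w₃ w₄ a b → ¬ E a b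

tails-differ : ∀ {n} {u v : Arrow n} {s t} → tail u ≡ s → tail v ≡ t → s ≢ t → u ≢ v
tails-differ tu≡s tv≡t s≢t u≡v = s≢t (trans (sym tu≡s) (trans (cong tail u≡v) tv≡t))

⅓ : ℚ
⅓ = ℤ.+ 1 ℚ./ 3

barycentre : ∀ {n} → Arrow n → Arrow n → Arrow n → Point n
barycentre u v w = combo (⅓ ∷ ⅓ ∷ ⅓ ∷ []) (u ∷ v ∷ w ∷ [])

barycentre-in-hull : ∀ {n} (u v w : Arrow n) → InConv (barycentre u v w) (u ∷ v ∷ w ∷ [])
barycentre-in-hull u v w =
  (⅓ ∷ ⅓ ∷ ⅓ ∷ []) , refl , (decide-≤ ∷ decide-≤ ∷ decide-≤ ∷ []) , refl , λ k → refl

barycentre-rotate-heads : ∀ {n} {t₁ t₂ t₃ h₁ h₂ h₃ : Fin (suc n)} {d₁ d₂ d₃ e₁ e₂ e₃} k →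
  barycentre (arrow t₁ h₁ d₁) (arrow t₂ h₂ d₂) (arrow t₃ h₃ d₃) k ≡
  barycentre (arrow t₁ h₂ e₁) (arrow t₂ h₃ e₂) (arrow t₃ h₁ e₃) k
barycentre-rotate-heads {t₁ = t₁} {t₂} {t₃} {h₁} {h₂} {h₃} k =
  solve 7 (λ c s₁ s₂ s₃ g₁ g₂ g₃ →
      c :* (g₁ :- s₁) :+ (c :* (g₂ :- s₂) :+ (c :* (g₃ :- s₃) :+ con 0ℚ))
   := c :* (g₂ :- s₁) :+ (c :* (g₃ :- s₂) :+ (c :* (g₁ :- s₃) :+ con 0ℚ)))
    refl ⅓ (δ t₁ k) (δ t₂ k) (δ t₃ k) (δ h₁ k) (δ h₂ k) (δ h₃ k)

module Triangulation {n : ℕ} {E : Arrow n → Arrow n → Set}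
  (symE : Symmetric E) (uniform : Uniform E) (RT : RepresentsTriangulation E) where

  covers : ∀ x → InBoundary x → ∃ λ σ → Face E σ × InConv x σ
  covers = proj₁ (proj₂ (proj₂ RT))

  meet-in-face : ∀ σ τ → Face E σ → Face E τ → ∀ x → InConv x σ → InConv x τ →
    ∃ λ ρ → ρ ⊆ₗ σ × ρ ⊆ₗ τ × InConv x ρ
  meet-in-face = proj₂ (proj₂ (proj₂ RT))

  clique-edge : ∀ {σ u v} → AllPairs E σ → u ∈ σ → v ∈ σ → u ≢ v → E u v
  clique-edge (_ ∷ _)      (here refl) (here refl) u≢v = ⊥-elim (u≢v refl)
  clique-edge (Eu ∷ _)     (here refl) (there v∈σ) _   = All.lookup Eu v∈σ
  clique-edge (Ev ∷ _)     (there u∈σ) (here refl) _   = symE _ _ (All.lookup Ev u∈σ)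
  clique-edge (_ ∷ clique) (there u∈σ) (there v∈σ) u≢v = clique-edge clique u∈σ v∈σ u≢v

  corner-in-face : ∀ a b {σ} → tail a ≢ tail b → head a ≢ head b → tail a ≢ head b → tail b ≢ head a →
    (∀ c d → HeadsSwapped a b c d → ¬ E c d) → AllPairs E σ → InConv (mid a b) σ →
    ∃ λ v → v ∈ σ × tail v ≡ tail a × head v ≡ head a
  corner-in-face a b {σ} ta≢tb ha≢hb ta≢hb tb≢ha no-swap clique x∈σ =
    from-tail-witness (find (tail-witness a b ta≢tb ta≢hb tb≢ha x∈σ))
    where
    Corner : Set
    Corner = ∃ λ v → v ∈ σ × tail v ≡ tail a × head v ≡ head a
    from-head-witness : ∀ {v} → v ∈ σ → tail v ≡ tail a → head v ≡ head b →
      (∃ λ u → u ∈ σ × head u ≡ head a × (tail u ≡ tail a ⊎ tail u ≡ tail b)) → Corner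
    from-head-witness _   _  _  (u , u∈σ , hu , inj₁ tu) = u , u∈σ , tu , hu
    from-head-witness v∈σ tv hv (u , u∈σ , hu , inj₂ tu) =
      ⊥-elim (no-swap _ _ (tv , hv , tu , hu) (clique-edge clique v∈σ u∈σ (tails-differ tv tu ta≢tb)))
    from-tail-witness : (∃ λ v → v ∈ σ × tail v ≡ tail a × (head v ≡ head a ⊎ head v ≡ head b)) → Corner
    from-tail-witness (v , v∈σ , tv , inj₁ hv) = v , v∈σ , tv , hv
    from-tail-witness (v , v∈σ , tv , inj₂ hv) =
      from-head-witness v∈σ tv hv (find (head-witness a b ha≢hb ta≢hb tb≢ha x∈σ))

  square-edge : ∀ a b → tail a ≢ tail b → head a ≢ head b → tail a ≢ head b → tail b ≢ head a →
    (∀ c d → HeadsSwapped a b c d → ¬ E c d) → E a b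
  square-edge a b ta≢tb ha≢hb ta≢hb tb≢ha no-swap =
    edge-in (covers (mid a b) (mid-InBoundary a b ta≢hb tb≢ha))
    where
    no-swap-ba : ∀ c d → HeadsSwapped b a c d → ¬ E c d
    no-swap-ba c d (tc , hc , td , hd) Ecd = no-swap d c (td , hd , tc , hc) (symE c d Ecd)
    from-corners : ∀ {σ} → AllPairs E σ →
      (∃ λ a′ → a′ ∈ σ × tail a′ ≡ tail a × head a′ ≡ head a) →
      (∃ λ b′ → b′ ∈ σ × tail b′ ≡ tail b × head b′ ≡ head b) → E a b
    from-corners clique (a′ , a′∈σ , ta′ , ha′) (b′ , b′∈σ , tb′ , hb′) =
      uniform-ends uniform ta′ ha′ tb′ hb′ (clique-edge clique a′∈σ b′∈σ (tails-differ ta′ tb′ ta≢tb))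
    edge-in : (∃ λ σ → Face E σ × InConv (mid a b) σ) → E a b
    edge-in (σ , (_ , clique) , x∈σ) = from-corners clique
      (corner-in-face a b ta≢tb ha≢hb ta≢hb tb≢ha no-swap clique x∈σ)
      (corner-in-face b a (≢-sym ta≢tb) (≢-sym ha≢hb) tb≢ha ta≢hb no-swap-ba clique
        (InConv-resp (mid-comm a b) x∈σ))

  separated-THTH-edge : DoesNotNest E T H T H → ∀ a b → SeparatedPair T H T H a b → E a b
  separated-THTH-edge no-nest a b (_ , _ , _ , _ , inc , refl , refl , refl , refl) =
    square-edge a b p₁≢p₃ p₂≢p₄ p₁≢p₄ (≢-sym p₂≢p₃)
      λ c d (tc , hc , td , hd) → no-nest c d (_ , _ , _ , _ , inc , tc , hc , hd , td)
    where open Increasing4-distinct inc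

  separated-HTHT-edge : DoesNotNest E H T H T → ∀ a b → SeparatedPair H T H T a b → E a b
  separated-HTHT-edge no-nest a b (_ , _ , _ , _ , inc , refl , refl , refl , refl) =
    square-edge a b p₂≢p₄ p₁≢p₃ p₂≢p₃ (≢-sym p₁≢p₄)
      λ c d (tc , hc , td , hd) Ecd → no-nest d c (_ , _ , _ , _ , inc , hd , td , tc , hc) (symE c d Ecd)
    where open Increasing4-distinct inc

  TTHH-nests : DoesNotCross E T T H H → Nests E T T H H
  TTHH-nests no-cross a b (_ , _ , _ , _ , inc , refl , refl , refl , refl) =
    square-edge a b p₁≢p₂ (≢-sym p₃≢p₄) p₁≢p₃ p₂≢p₄
      λ c d (tc , hc , td , hd) → no-cross c d (_ , _ , _ , _ , inc , tc , hc , td , hd)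
    where open Increasing4-distinct inc

  HHTT-nests : DoesNotCross E H H T T → Nests E H H T T
  HHTT-nests no-cross a b (_ , _ , _ , _ , inc , refl , refl , refl , refl) =
    square-edge a b (≢-sym p₃≢p₄) p₁≢p₂ (≢-sym p₂≢p₄) (≢-sym p₁≢p₃)
      λ c d (tc , hc , td , hd) Ecd → no-cross d c (_ , _ , _ , _ , inc , hd , td , hc , tc) (symE c d Ecd)
    where open Increasing4-distinct inc

  Triangle : Arrow n → Arrow n → Arrow n → Set
  Triangle u v w = E u v × E u w × E v w

  triangle-face : ∀ {u v w} → tail u ≢ tail v → tail u ≢ tail w → tail v ≢ tail w → Triangle u v w →
    Face E (u ∷ v ∷ w ∷ [])
  triangle-face tu≢tv tu≢tw tv≢tw (Euv , Euw , Evw) =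
    ((tu≢tv ∘ cong tail ∷ tu≢tw ∘ cong tail ∷ []) ∷ (tv≢tw ∘ cong tail ∷ []) ∷ [] ∷ []) ,
    ((Euv ∷ Euw ∷ []) ∷ (Evw ∷ []) ∷ [] ∷ [])

  disjoint-faces-share-no-point : ∀ {σ τ x} → Face E σ → Face E τ → InConv x σ → InConv x τ →
    (∀ {v} → v ∈ σ → v ∈ τ → ⊥) → ⊥
  disjoint-faces-share-no-point {σ} {τ} {x} σ-face τ-face x∈σ x∈τ disjoint =
    common-vertex (meet-in-face σ τ σ-face τ-face x x∈σ x∈τ)
    where
    common-vertex : (∃ λ ρ → ρ ⊆ₗ σ × ρ ⊆ₗ τ × InConv x ρ) → ⊥
    common-vertex ([]    , _       , _       , []    , _ , _ , () , _)
    common-vertex ([]    , _       , _       , _ ∷ _ , () , _)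
    common-vertex (_ ∷ _ , v∈σ ∷ _ , v∈τ ∷ _ , _) = disjoint v∈σ v∈τ

  rotated-triangles-not-both-cliques : ∀ {t₁ t₂ t₃ h₁ h₂ h₃ d₁ d₂ d₃ e₁ e₂ e₃} →
    Triangle (arrow t₁ h₁ d₁) (arrow t₂ h₂ d₂) (arrow t₃ h₃ d₃) →
    Triangle (arrow t₁ h₂ e₁) (arrow t₂ h₃ e₂) (arrow t₃ h₁ e₃) →
    t₁ ≢ t₂ → t₁ ≢ t₃ → t₂ ≢ t₃ → h₁ ≢ h₂ → h₁ ≢ h₃ → h₂ ≢ h₃ → ⊥
  rotated-triangles-not-both-cliques {t₁} {t₂} {t₃} {h₁} {h₂} {h₃} {d₁} {d₂} {d₃} {e₁} {e₂} {e₃}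
    σ-edges τ-edges t₁≢t₂ t₁≢t₃ t₂≢t₃ h₁≢h₂ h₁≢h₃ h₂≢h₃ =
    disjoint-faces-share-no-point
      (triangle-face t₁≢t₂ t₁≢t₃ t₂≢t₃ σ-edges) (triangle-face t₁≢t₂ t₁≢t₃ t₂≢t₃ τ-edges)
      (barycentre-in-hull _ _ _) (InConv-resp (λ k → sym (rotate k)) (barycentre-in-hull _ _ _)) disjoint
    where
    σ τ : List (Arrow n)
    σ = arrow t₁ h₁ d₁ ∷ arrow t₂ h₂ d₂ ∷ arrow t₃ h₃ d₃ ∷ []
    τ = arrow t₁ h₂ e₁ ∷ arrow t₂ h₃ e₂ ∷ arrow t₃ h₁ e₃ ∷ []
    rotate : ∀ k → barycentre (arrow t₁ h₁ d₁) (arrow t₂ h₂ d₂) (arrow t₃ h₃ d₃) k ≡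
                   barycentre (arrow t₁ h₂ e₁) (arrow t₂ h₃ e₂) (arrow t₃ h₁ e₃) k
    rotate = barycentre-rotate-heads {t₁ = t₁} {t₂} {t₃} {h₁} {h₂} {h₃} {d₁} {d₂} {d₃} {e₁} {e₂} {e₃}
    disjoint : ∀ {v} → v ∈ σ → v ∈ τ → ⊥
    disjoint (here refl)                 (here eq)                 = h₁≢h₂ (cong head eq)
    disjoint (here refl)                 (there (here eq))         = t₁≢t₂ (cong tail eq)
    disjoint (here refl)                 (there (there (here eq))) = t₁≢t₃ (cong tail eq)
    disjoint (there (here refl))         (here eq)                 = t₁≢t₂ (sym (cong tail eq))
    disjoint (there (here refl))         (there (here eq))         = h₂≢h₃ (cong head eq)
    disjoint (there (here refl))         (there (there (here eq))) = t₂≢t₃ (cong tail eq)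
    disjoint (there (there (here refl))) (here eq)                 = t₁≢t₃ (sym (cong tail eq))
    disjoint (there (there (here refl))) (there (here eq))         = t₂≢t₃ (sym (cong tail eq))
    disjoint (there (there (here refl))) (there (there (here eq))) = h₁≢h₃ (sym (cong head eq))

module Hexagon {m : ℕ}
  {E : Arrow (suc (suc (suc (suc (suc m))))) → Arrow (suc (suc (suc (suc (suc m))))) → Set}
  (symE : Symmetric E) (uniform : Uniform E) (RT : RepresentsTriangulation E) where

  open Triangulation symE uniform RT

  Index : Set
  Index = Fin (suc (suc (suc (suc (suc (suc m))))))

  infix 5 _↦_
  _↦_ : (i j : Index) {i≢j : False (i ≟ j)} → Arrow (suc (suc (suc (suc (suc m)))))
  (i ↦ j) {i≢j} = arrow i j (toWitnessFalse i≢j)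

  increasing : ∀ {p₁ p₂ p₃ p₄ : Index} {p₁<p₂ : True (p₁ Finₚ.<? p₂)} {p₂<p₃ : True (p₂ Finₚ.<? p₃)}
    {p₃<p₄ : True (p₃ Finₚ.<? p₄)} → Increasing4 p₁ p₂ p₃ p₄
  increasing {p₁<p₂ = p₁<p₂} {p₂<p₃} {p₃<p₄} = toWitness p₁<p₂ , toWitness p₂<p₃ , toWitness p₃<p₄

  CaseHypothesis : Set
  CaseHypothesis = (Nests E T H T H × DoesNotNest E H T H T) ⊎ (DoesNotNest E T H T H × Nests E H T H T)

  TTHH-does-not-cross : CaseHypothesis → Crosses E T H H T → Crosses E H T T H → DoesNotCross E T T H H
  TTHH-does-not-cross cases THHT-crosses HTTH-crosses c d crossing Ecd = clash cases
    where
    σ₀ : DoesNotNest E T H T H → Triangle (# 0 ↦ # 1) (# 2 ↦ # 3) (# 4 ↦ # 5)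
    σ₀ THTH-does-not-nest =
        separated-THTH-edge THTH-does-not-nest _ _ (# 0 , # 1 , # 2 , # 3 , increasing , refl , refl , refl , refl)
      , separated-THTH-edge THTH-does-not-nest _ _ (# 0 , # 1 , # 4 , # 5 , increasing , refl , refl , refl , refl)
      , separated-THTH-edge THTH-does-not-nest _ _ (# 2 , # 3 , # 4 , # 5 , increasing , refl , refl , refl , refl)
    σ₁ : Triangle (# 0 ↦ # 3) (# 2 ↦ # 5) (# 4 ↦ # 1)
    σ₁ = crossing-uniform uniform {T} {T} {H} {H} crossing
           (# 0 , # 2 , # 3 , # 5 , increasing , refl , refl , refl , refl) Ecd
       , THHT-crosses _ _ (# 0 , # 1 , # 3 , # 4 , increasing , refl , refl , refl , refl)
       , symE _ _ (HTTH-crosses _ _ (# 1 , # 2 , # 4 , # 5 , increasing , refl , refl , refl , refl))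
    σ₂ : Nests E T H T H → DoesNotNest E H T H T → Triangle (# 0 ↦ # 5) (# 2 ↦ # 1) (# 4 ↦ # 3)
    σ₂ THTH-nests HTHT-does-not-nest =
        THTH-nests _ _ (# 0 , # 1 , # 2 , # 5 , increasing , refl , refl , refl , refl)
      , THTH-nests _ _ (# 0 , # 3 , # 4 , # 5 , increasing , refl , refl , refl , refl)
      , separated-HTHT-edge HTHT-does-not-nest _ _ (# 1 , # 2 , # 3 , # 4 , increasing , refl , refl , refl , refl)
    clash : CaseHypothesis → ⊥
    clash (inj₁ (THTH-nests , HTHT-does-not-nest)) =
      rotated-triangles-not-both-cliques σ₁ (σ₂ THTH-nests HTHT-does-not-nest)
        (λ ()) (λ ()) (λ ()) (λ ()) (λ ()) (λ ())
    clash (inj₂ (THTH-does-not-nest , _)) =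
      rotated-triangles-not-both-cliques (σ₀ THTH-does-not-nest) σ₁
        (λ ()) (λ ()) (λ ()) (λ ()) (λ ()) (λ ())

  HHTT-does-not-cross : CaseHypothesis → Crosses E T H H T → Crosses E H T T H → DoesNotCross E H H T T
  HHTT-does-not-cross cases THHT-crosses HTTH-crosses c d crossing Ecd = clash cases
    where
    τ₀ : DoesNotNest E H T H T → Triangle (# 1 ↦ # 0) (# 3 ↦ # 2) (# 5 ↦ # 4)
    τ₀ HTHT-does-not-nest =
        separated-HTHT-edge HTHT-does-not-nest _ _ (# 0 , # 1 , # 2 , # 3 , increasing , refl , refl , refl , refl)
      , separated-HTHT-edge HTHT-does-not-nest _ _ (# 0 , # 1 , # 4 , # 5 , increasing , refl , refl , refl , refl)
      , separated-HTHT-edge HTHT-does-not-nest _ _ (# 2 , # 3 , # 4 , # 5 , increasing , refl , refl , refl , refl)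
    τ₁ : DoesNotNest E T H T H → Nests E H T H T → Triangle (# 1 ↦ # 2) (# 3 ↦ # 4) (# 5 ↦ # 0)
    τ₁ THTH-does-not-nest HTHT-nests =
        separated-THTH-edge THTH-does-not-nest _ _ (# 1 , # 2 , # 3 , # 4 , increasing , refl , refl , refl , refl)
      , symE _ _ (HTHT-nests _ _ (# 0 , # 1 , # 2 , # 5 , increasing , refl , refl , refl , refl))
      , symE _ _ (HTHT-nests _ _ (# 0 , # 3 , # 4 , # 5 , increasing , refl , refl , refl , refl))
    τ₂ : Triangle (# 1 ↦ # 4) (# 3 ↦ # 0) (# 5 ↦ # 2)
    τ₂ = symE _ _ (HTTH-crosses _ _ (# 0 , # 1 , # 3 , # 4 , increasing , refl , refl , refl , refl))
       , THHT-crosses _ _ (# 1 , # 2 , # 4 , # 5 , increasing , refl , refl , refl , refl)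
       , crossing-uniform uniform {H} {H} {T} {T} crossing
           (# 0 , # 2 , # 3 , # 5 , increasing , refl , refl , refl , refl) Ecd
    clash : CaseHypothesis → ⊥
    clash (inj₁ (_ , HTHT-does-not-nest)) =
      rotated-triangles-not-both-cliques τ₂ (τ₀ HTHT-does-not-nest)
        (λ ()) (λ ()) (λ ()) (λ ()) (λ ()) (λ ())
    clash (inj₂ (THTH-does-not-nest , HTHT-nests)) =
      rotated-triangles-not-both-cliques (τ₁ THTH-does-not-nest HTHT-nests) τ₂
        (λ ()) (λ ()) (λ ()) (λ ()) (λ ()) (λ ())

proposition3p7 : (n : ℕ) → 5 ≤ n → (E : Arrow n → Arrow n → Set) →
    Symmetric E → Uniform E → RepresentsTriangulation E →
    ((Nests E T H T H × DoesNotNest E H T H T) ⊎ (DoesNotNest E T H T H × Nests E H T H T)) →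
    Crosses E T H H T → Crosses E H T T H →
    Nests E T T H H × Nests E H H T T
proposition3p7 _ (s≤s (s≤s (s≤s (s≤s (s≤s z≤n))))) E symE uniform RT cases THHT-crosses HTTH-crosses =
  TTHH-nests (TTHH-does-not-cross cases THHT-crosses HTTH-crosses) ,
  HHTT-nests (HHTT-does-not-cross cases THHT-crosses HTTH-crosses)
  where
  open Triangulation symE uniform RT
  open Hexagon symE uniform RT
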